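{- Let $k\ge1$, and let $p,q$ be positive integers with $p\ge q$, with canonical $k$-representations $p=\sum_{i}\binom{a_{k-i}}{k-i}$ and $q=\sum_i\binom{b_{k-i}}{k-i}$. Let $N=p+\sum_i\binom{b_{k-i}}{k-1-i}$, and let $N=\sum_i\binom{c_{k-i}}{k-i}$ be its canonical $k$-representation. Then $$\sum_i\binom{c_{k-i}}{k+1-i}\ge\sum_i\binom{a_{k-i}}{k+1-i}+\sum_i\binom{b_{k-i}}{k-i}.$$
   Context: $\binom{n}{l}=0$ if $l>n$ or $l<0$. The canonical $k$-representation of a positive integer $p$ is the unique expression $p=\sum_{i=0}^s\binom{a_{k-i}}{k-i}$ with $s\ge0$ and $a_k>a_{k-1}>\dots>a_{k-s}\ge k-s>0$; sums over $i$ run over the indices present in the respective representation. -}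

module Defs where

open import Data.Nat using (ℕ; zero; suc; _+_; _∸_; _≤_; _<_; _≥_)
open import Data.Nat.Combinatorics using (_C_)
open import Data.Fin using (Fin; toℕ; fromℕ) renaming (_<_ to _<ᶠ_)
open import Data.List using (tabulate)
open import Data.Nat.ListAction using (sum)
open import Relation.Binary.PropositionalEquality using (_≡_)

Σ≤ : (s : ℕ) → (Fin (suc s) → ℕ) → ℕ
Σ≤ s f = sum (tabulate f)

-- A canonical k-representation of p:
--   p = Σ_{i=0}^{s} (a_{k-i} choose k-i),
--   a_k > a_{k-1} > ... > a_{k-s} ≥ k-s > 0.
-- The coefficient a_{k-i} is stored as  coeff i  for i : Fin (suc s).
record CanonRep (k p : ℕ) : Set where
  field
    s      : ℕ
    coeff  : Fin (suc s) → ℕ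
    s<k    : s < k
    decr   : ∀ (i j : Fin (suc s)) → i <ᶠ j → coeff j < coeff i
    lastGe : coeff (fromℕ s) ≥ k ∸ s
    sumEq  : p ≡ Σ≤ s (λ i → coeff i C (k ∸ toℕ i))

open CanonRep public

-- Since i ≤ s < k,
-- the truncated subtraction is exact for m ∈ {k-1, k, k+1}.
shiftSum : ∀ {k p} → CanonRep k p → ℕ → ℕ
shiftSum r m = Σ≤ (s r) (λ i → coeff r i C (m ∸ toℕ i))

module Submission where

-- colex j m lists the values min S (min ∅ = m) over the j-subsets S of {0,…,m-1} in
-- colexicographic order: (m choose j) entries summing to (m choose j+1).  For a canonical
-- representation x = Σᵢ (aᵢ choose k-i) with a₀ < m, the sum of the first x entries of
-- colex k m is the upper function Σᵢ (aᵢ choose k+1-i), and the recursively defined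
-- shadow k m x is the lower function Σᵢ (aᵢ choose k-1-i).
--
-- From them
-- the main inequality  prefix (colex k m) p + q ≤ prefix (colex k (m+1)) (p + shadow k m q)
-- (q ≤ p ≤ (m choose k)) follows by induction.  Evaluating canonical representations in
-- the model with m = a₀ + 1 turns it into Lemma 3.3.

open import Defs
open import Data.Nat using (ℕ; zero; suc; pred; _+_; _*_; _∸_; _≤_; _<_; _≥_; z≤n; s≤s; _≤?_)
open import Data.Nat.Properties
open import Data.Nat.Combinatorics using (_C_; nCk+nC[k+1]≡[n+1]C[k+1])
open import Data.Nat.ListAction using (sum)
open import Data.Nat.ListAction.Properties using (sum-++)
open import Data.Fin using (Fin; toℕ; fromℕ) renaming (zero to fz; suc to fs; _<_ to _<ᶠ_)
open import Data.List using (List; []; _∷_; _++_; length; take)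
open import Data.List.Properties using (length-++)
open import Data.Product using (∃; _×_; _,_; proj₁; proj₂)
open import Data.Sum using (_⊎_; inj₁; inj₂)
open import Data.Empty using (⊥-elim)
open import Relation.Binary.PropositionalEquality
open import Relation.Nullary using (yes; no)
open import Data.Nat.Tactic.RingSolver using (solve; solve-∀)

-- To prove L ≤ R it suffices to find a ≤ b with L + b = R + a; the equation is
-- then a pure semiring identity for the ring solver.
≤-by-balance : ∀ {L R a b : ℕ} → a ≤ b → L + b ≡ R + a → L ≤ R
≤-by-balance {L} {R} {a} {b} a≤b eq =
  +-cancelʳ-≤ b L R (≤-trans (≤-reflexive eq) (+-monoʳ-≤ R a≤b))

≤-cast : ∀ {x x' y y' : ℕ} → x ≡ x' → y ≡ y' → x' ≤ y' → x ≤ y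
≤-cast refl refl h = h

≤-or-beyond : ∀ x n → x ≤ n ⊎ ∃ λ y → x ≡ n + y
≤-or-beyond x n with x ≤? n
... | yes x≤n = inj₁ x≤n
... | no x≰n = inj₂ (x ∸ n , sym (m+[n∸m]≡n (<⇒≤ (≰⇒> x≰n))))

≤-or-strictly-beyond : ∀ x n → x ≤ n ⊎ ∃ λ t → x ≡ n + suc t
≤-or-strictly-beyond x n with x ≤? n
... | yes x≤n = inj₁ x≤n
... | no x≰n = inj₂ (x ∸ suc n , trans (sym (m+[n∸m]≡n (≰⇒> x≰n))) (sym (+-suc n (x ∸ suc n))))

complement : ∀ {x n} → x ≤ n → ∃ λ y → y + x ≡ n
complement {x} {n} x≤n = n ∸ x , m∸n+n≡m x≤n

-- Binomial coefficients by Pascal's rule, which makes induction convenient.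
binom : ℕ → ℕ → ℕ
binom n zero = 1
binom zero (suc k) = 0
binom (suc n) (suc k) = binom n (suc k) + binom n k

binom≡C : ∀ n k → binom n k ≡ n C k
binom≡C n zero = refl
binom≡C zero (suc k) = refl
binom≡C (suc n) (suc k) = begin
  binom n (suc k) + binom n k  ≡⟨ cong₂ _+_ (binom≡C n (suc k)) (binom≡C n k) ⟩
  n C suc k + n C k            ≡⟨ +-comm (n C suc k) (n C k) ⟩
  n C k + n C suc k            ≡⟨ nCk+nC[k+1]≡[n+1]C[k+1] n k ⟩
  suc n C suc k                ∎
  where open ≡-Reasoning

binom-1 : ∀ n → binom n 1 ≡ n
binom-1 zero = refl
binom-1 (suc n) = trans (+-comm (binom n 1) 1) (cong suc (binom-1 n))

-- (n choose k) is positive for k ≤ n; stated with an explicit predecessor so that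
-- it can be used to expose a successor.
binom-positive : ∀ n k → k ≤ n → ∃ λ t → binom n k ≡ suc t
binom-positive n zero _ = 0 , refl
binom-positive (suc n) (suc k) (s≤s k≤n) with binom-positive n k k≤n
... | t , eq = binom n (suc k) + t , trans (cong (binom n (suc k) +_) eq) (+-suc (binom n (suc k)) t)

binom-mono-step : ∀ n k → binom n k ≤ binom (suc n) k
binom-mono-step n zero = ≤-refl
binom-mono-step n (suc k) = m≤m+n (binom n (suc k)) (binom n k)

binom-mono : ∀ n d k → binom n k ≤ binom (n + d) k
binom-mono n zero k = ≤-reflexive (cong (λ x → binom x k) (sym (+-identityʳ n)))
binom-mono n (suc d) k = ≤-trans (binom-mono n d k)
  (≤-trans (binom-mono-step (n + d) k) (≤-reflexive (cong (λ x → binom x k) (sym (+-suc n d)))))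

binom-absorb : ∀ n k → suc k * binom (suc n) (suc k) ≡ suc n * binom n k
binom-absorb zero zero = refl
binom-absorb zero (suc k) = *-zeroʳ (suc (suc k))
binom-absorb (suc n) zero =
  trans (+-identityʳ _) (trans (binom-1 (suc (suc n))) (sym (*-identityʳ (suc (suc n)))))
binom-absorb (suc n) (suc k) = begin
  suc (suc k) * (X' + Y')                              ≡⟨ *-distribˡ-+ (suc (suc k)) X' Y' ⟩
  suc (suc k) * X' + suc (suc k) * Y'                  ≡⟨ cong (_+ suc (suc k) * Y') (binom-absorb n (suc k)) ⟩
  suc n * X + (Y' + suc k * Y')                        ≡⟨ cong (λ z → suc n * X + (Y' + z)) (binom-absorb n k) ⟩
  suc n * X + ((X + Y) + suc n * Y)                    ≡⟨ regroup (suc n) X Y ⟩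
  suc (suc n) * (X + Y)                                ∎
  where
  open ≡-Reasoning
  X = binom n (suc k)
  Y = binom n k
  X' = binom (suc n) (suc (suc k))
  Y' = binom (suc n) (suc k)
  regroup : ∀ a x y → a * x + ((x + y) + a * y) ≡ suc a * (x + y)
  regroup = solve-∀

binom-descent : ∀ m j → binom m (suc j) < binom m j → suc m < suc j + suc j
binom-descent m j Y<X = *-cancelʳ-< X (suc m) (suc j + suc j) (begin-strict
  suc m * X                ≡⟨ binom-absorb m j ⟨
  suc j * (binom m (suc j) + X) <⟨ *-monoʳ-< (suc j) (+-monoˡ-< X Y<X) ⟩
  suc j * (X + X)          ≡⟨ doubling (suc j) X ⟩
  (suc j + suc j) * X      ∎)
  where
  open ≤-Reasoning
  X = binom m j
  doubling : ∀ a x → a * (x + x) ≡ (a + a) * x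
  doubling = solve-∀

binom-ascent : ∀ m j → binom m (suc j) < binom m (suc (suc j)) → suc (suc j) + suc (suc j) < suc m
binom-ascent m j Y<Z = *-cancelʳ-< Y (suc (suc j) + suc (suc j)) (suc m) (begin-strict
  (suc (suc j) + suc (suc j)) * Y ≡⟨ doubling (suc (suc j)) Y ⟨
  suc (suc j) * (Y + Y)           <⟨ *-monoʳ-< (suc (suc j)) (+-monoˡ-< Y Y<Z) ⟩
  suc (suc j) * (binom m (suc (suc j)) + Y) ≡⟨ binom-absorb m (suc j) ⟩
  suc m * Y                       ∎)
  where
  open ≤-Reasoning
  Y = binom m (suc j)
  doubling : ∀ a x → a * (x + x) ≡ (a + a) * x
  doubling = solve-∀

binom-unimodal : ∀ m j v → v ≤ binom m j → v ≤ binom m (suc (suc j)) → v ≤ binom m (suc j)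
binom-unimodal m j v v≤X v≤Z with v ≤? binom m (suc j)
... | yes v≤Y = v≤Y
... | no v≰Y = ⊥-elim (<⇒≱ (<-trans (binom-ascent m j (≤-trans Y<v v≤Z)) (binom-descent m j (≤-trans Y<v v≤X)))
                           (+-mono-≤ (n≤1+n (suc j)) (n≤1+n (suc j))))
  where
  Y<v : binom m (suc j) < v
  Y<v = ≰⇒> v≰Y

prefix : List ℕ → ℕ → ℕ
prefix xs n = sum (take n xs)

prefix-all : ∀ xs → prefix xs (length xs) ≡ sum xs
prefix-all [] = refl
prefix-all (x ∷ xs) = cong (x +_) (prefix-all xs)

prefix-++ˡ : ∀ A B x → x ≤ length A → prefix (A ++ B) x ≡ prefix A x
prefix-++ˡ A B zero _ = refl
prefix-++ˡ (a ∷ A) B (suc x) (s≤s x≤) = cong (a +_) (prefix-++ˡ A B x x≤)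

prefix-++ʳ : ∀ A B {x} s → x ≡ length A + s → prefix (A ++ B) x ≡ sum A + prefix B s
prefix-++ʳ [] B s refl = refl
prefix-++ʳ (a ∷ A) B s refl =
  trans (cong (a +_) (prefix-++ʳ A B s refl)) (sym (+-assoc a (sum A) (prefix B s)))

-- Window comparisons.  A window of xs is a block of consecutive entries; its sum is
-- a difference of two prefix sums, written additively below.

-- Every window [a, a+e) has sum at least that of the initial window [0, e).
InitialMinimal : List ℕ → Set
InitialMinimal xs = ∀ a e → a + e ≤ length xs → prefix xs e + prefix xs a ≤ prefix xs (a + e)

-- Every window [a, a+e) has sum at most that of the final window [c, c+e).
FinalMaximal : List ℕ → Set
FinalMaximal xs = ∀ a e c → a + e ≤ length xs → c + e ≡ length xs →
  prefix xs (a + e) + prefix xs c ≤ prefix xs a + sum xs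

PrefixBelow : List ℕ → List ℕ → Set
PrefixBelow xs ys = ∀ e → e ≤ length xs → e ≤ length ys → prefix xs e ≤ prefix ys e

-- Final windows of xs are dominated by the final windows of ys of equal length.
SuffixBelow : List ℕ → List ℕ → Set
SuffixBelow xs ys = ∀ e c₁ c₂ → c₁ + e ≡ length xs → c₂ + e ≡ length ys →
  sum xs + prefix ys c₂ ≤ prefix xs c₁ + sum ys

final-window-in-second : ∀ c e nA nB → c + e ≡ nA + nB → e ≤ nB →
  ∃ λ c' → c ≡ nA + c' × c' + e ≡ nB
final-window-in-second c e nA nB eq e≤nB with complement e≤nB
... | c' , c'+e≡nB = c' , +-cancelʳ-≡ e _ _ (begin
  c + e           ≡⟨ eq ⟩
  nA + nB         ≡⟨ cong (nA +_) c'+e≡nB ⟨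
  nA + (c' + e)   ≡⟨ +-assoc nA c' e ⟨
  nA + c' + e     ∎) , c'+e≡nB
  where open ≡-Reasoning

final-window-covers-second : ∀ c f nA nB → c + (nB + f) ≡ nA + nB → c + f ≡ nA
final-window-covers-second c f nA nB eq = +-cancelʳ-≡ nB _ _ (trans (shuffle c f nB) eq)
  where
  shuffle : ∀ c f n → c + f + n ≡ c + (n + f)
  shuffle = solve-∀

module Concatenation {A B : List ℕ}
  (minA : InitialMinimal A) (maxA : FinalMaximal A)
  (minB : InitialMinimal B) (maxB : FinalMaximal B)
  (prefixAB : PrefixBelow A B) (suffixAB : SuffixBelow A B) where

  nA nB : ℕ
  nA = length A
  nB = length B

  length-AB : length (A ++ B) ≡ nA + nB
  length-AB = length-++ A

  prefixA≤sumB : nA ≤ nB → sum A ≤ prefix B nA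
  prefixA≤sumB nA≤nB = ≤-cast (sym (prefix-all A)) refl (prefixAB nA ≤-refl nA≤nB)

  initialMinimal-inside-B : ∀ a' e → a' + e ≤ nB →
    prefix (A ++ B) e + prefix (A ++ B) (nA + a') ≤ prefix (A ++ B) (nA + a' + e)
  initialMinimal-inside-B a' e a'+e≤ with ≤-or-beyond e nA
  ... | inj₁ e≤nA =
    ≤-cast (cong₂ _+_ (prefix-++ˡ A B e e≤nA) (prefix-++ʳ A B a' refl)) (prefix-++ʳ A B (a' + e) (+-assoc nA a' e))
      (combine _ _ _ _ _ (prefixAB e e≤nA (m+n≤o⇒n≤o a' a'+e≤)) (minB a' e a'+e≤))
    where
    combine : ∀ (x y s p q : ℕ) → x ≤ y → y + p ≤ q → x + (s + p) ≤ s + q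
    combine x y s p q h₁ h₂ = ≤-by-balance (+-mono-≤ h₁ h₂) (solve (x ∷ y ∷ s ∷ p ∷ q ∷ []))
  ... | inj₂ (v , refl) =
    ≤-cast (cong₂ _+_ (prefix-++ʳ A B v refl) (prefix-++ʳ A B a' refl)) (prefix-++ʳ A B (a' + nA + v) (regroup nA a' v))
      (combine _ _ _ _ _ _ (prefixA≤sumB (m+n≤o⇒n≤o a' first≤)) (minB a' nA first≤) (minB (a' + nA) v both≤))
    where
    regroup : ∀ n a v → n + a + (n + v) ≡ n + (a + n + v)
    regroup = solve-∀
    both≤ : a' + nA + v ≤ nB
    both≤ = ≤-trans (≤-reflexive (+-assoc a' nA v)) a'+e≤
    first≤ : a' + nA ≤ nB
    first≤ = ≤-trans (m≤m+n (a' + nA) v) both≤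
    combine : ∀ (s pv pa pn pan pf : ℕ) → s ≤ pn → pn + pa ≤ pan → pv + pan ≤ pf → (s + pv) + (s + pa) ≤ s + pf
    combine s pv pa pn pan pf h₁ h₂ h₃ =
      ≤-by-balance (+-mono-≤ (+-mono-≤ h₁ h₂) h₃) (solve (s ∷ pv ∷ pa ∷ pn ∷ pan ∷ pf ∷ []))

  initialMinimal-straddling : ∀ a e w → a ≤ nA → a + e ≡ nA + w → w ≤ nB →
    prefix (A ++ B) e + prefix (A ++ B) a ≤ prefix (A ++ B) (a + e)
  initialMinimal-straddling a e w a≤nA a+e≡ w≤nB with ≤-or-beyond e nA
  ... | inj₁ e≤nA =
    ≤-cast (cong₂ _+_ (trans (prefix-++ˡ A B e e≤nA) (cong (prefix A) e≡)) (prefix-++ˡ A B a a≤nA)) (prefix-++ʳ A B w a+e≡)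
      (combine (prefix A (w + e₁)) (prefix A a) (prefix A w) (sum A) (prefix B w)
        (maxA w e₁ a (≤-trans (≤-reflexive (sym e≡)) e≤nA) a+e₁≡) (prefixAB w w≤nA w≤nB))
    where
    e₁ : ℕ
    e₁ = nA ∸ a
    a+e₁≡ : a + e₁ ≡ nA
    a+e₁≡ = m+[n∸m]≡n a≤nA
    e≡ : e ≡ w + e₁
    e≡ = +-cancelˡ-≡ a _ _ (trans a+e≡ (trans (cong (_+ w) (sym a+e₁≡)) (shuffle a e₁ w)))
      where
      shuffle : ∀ a e w → a + e + w ≡ a + (w + e)
      shuffle = solve-∀
    w≤nA : w ≤ nA
    w≤nA = ≤-trans (m≤m+n w e₁) (≤-trans (≤-reflexive (sym e≡)) e≤nA)
    combine : ∀ (x pa pw s qw : ℕ) → x + pa ≤ pw + s → pw ≤ qw → x + pa ≤ s + qw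
    combine x pa pw s qw h₁ h₂ = ≤-by-balance (+-mono-≤ h₁ h₂) (solve (x ∷ pa ∷ pw ∷ s ∷ qw ∷ []))
  ... | inj₂ (v , refl) =
    ≤-cast (cong₂ _+_ (prefix-++ʳ A B v refl) (prefix-++ˡ A B a a≤nA)) (trans (prefix-++ʳ A B w a+e≡) (cong (λ z → sum A + prefix B z) w≡))
      (combine _ _ _ _ _ (prefixAB a a≤nA (m+n≤o⇒m≤o a a+v≤)) (minB a v a+v≤))
    where
    w≡ : w ≡ a + v
    w≡ = +-cancelˡ-≡ nA _ _ (trans (sym a+e≡) (shuffle a nA v))
      where
      shuffle : ∀ a n v → a + (n + v) ≡ n + (a + v)
      shuffle = solve-∀
    a+v≤ : a + v ≤ nB
    a+v≤ = ≤-trans (≤-reflexive (sym w≡)) w≤nB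
    combine : ∀ (pa qa pv r s : ℕ) → pa ≤ qa → pv + qa ≤ r → (s + pv) + pa ≤ s + r
    combine pa qa pv r s h₁ h₂ = ≤-by-balance (+-mono-≤ h₁ h₂) (solve (pa ∷ qa ∷ pv ∷ r ∷ s ∷ []))

  initialMinimal-++ : InitialMinimal (A ++ B)
  initialMinimal-++ a e a+e≤ with ≤-or-beyond (a + e) nA | ≤-or-beyond a nA
  ... | inj₁ a+e≤nA | _ =
    ≤-cast (cong₂ _+_ (prefix-++ˡ A B e (m+n≤o⇒n≤o a a+e≤nA)) (prefix-++ˡ A B a (m+n≤o⇒m≤o a a+e≤nA)))
      (prefix-++ˡ A B (a + e) a+e≤nA) (minA a e a+e≤nA)
  ... | inj₂ _ | inj₂ (a' , refl) =
    initialMinimal-inside-B a' e (+-cancelˡ-≤ nA _ _ (≤-trans (≤-reflexive (sym (+-assoc nA a' e))) (≤-trans a+e≤ (≤-reflexive length-AB))))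
  ... | inj₂ (w , a+e≡) | inj₁ a≤nA =
    initialMinimal-straddling a e w a≤nA a+e≡ (+-cancelˡ-≤ nA _ _ (≤-trans (≤-reflexive (sym a+e≡)) (≤-trans a+e≤ (≤-reflexive length-AB))))

  finalMaximal-inside-A : ∀ a e c → a + e ≤ nA → c + e ≡ nA + nB →
    prefix (A ++ B) (a + e) + prefix (A ++ B) c ≤ prefix (A ++ B) a + (sum A + sum B)
  finalMaximal-inside-A a e c a+e≤nA c+e≡ with ≤-or-beyond e nB
  -- the final window lies in B: pass through the final window of A
  ... | inj₁ e≤nB with final-window-in-second c e nA nB c+e≡ e≤nB | complement (m+n≤o⇒n≤o a a+e≤nA)
  ...   | c' , refl , c'+e≡ | cA , cA+e≡ =
    ≤-cast (cong₂ _+_ (prefix-++ˡ A B (a + e) a+e≤nA) (prefix-++ʳ A B c' refl)) (cong (_+ _) (prefix-++ˡ A B a (m+n≤o⇒m≤o a a+e≤nA)))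
      (combine (prefix A (a + e)) (prefix A cA) (prefix A a) (sum A) (prefix B c') (sum B)
        (maxA a e cA a+e≤nA cA+e≡) (suffixAB e cA c' cA+e≡ c'+e≡))
    where
    combine : ∀ (x y z s p t : ℕ) → x + y ≤ z + s → s + p ≤ y + t → x + (s + p) ≤ z + (s + t)
    combine x y z s p t h₁ h₂ = ≤-by-balance (+-mono-≤ h₁ h₂) (solve (x ∷ y ∷ z ∷ s ∷ p ∷ t ∷ []))
  -- the final window covers B: split the window into a part of length f and one of length nB
  finalMaximal-inside-A a e c a+e≤nA c+e≡ | inj₂ (f , refl) with complement (m+n≤o⇒n≤o (a + f) a+f+nB≤)
    where
    a+f+nB≤ : a + f + nB ≤ nA
    a+f+nB≤ = ≤-trans (≤-reflexive (sym (shuffle a nB f))) a+e≤nA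
      where
      shuffle : ∀ a n f → a + (n + f) ≡ a + f + n
      shuffle = solve-∀
  ... | c₃ , c₃+nB≡ =
    ≤-cast (cong₂ _+_ (trans (prefix-++ˡ A B (a + (nB + f)) a+e≤nA) (cong (prefix A) (shuffle a nB f))) (prefix-++ˡ A B c c≤nA))
      (cong (_+ _) (prefix-++ˡ A B a (m+n≤o⇒m≤o a a+e≤nA)))
      (combine (prefix A (a + f)) (prefix A c) (prefix A a) (sum A) (prefix A (a + f + nB)) (prefix A c₃) (sum B)
        (maxA a f c a+f≤ c+f≡) (maxA (a + f) nB c₃ a+f+nB≤ c₃+nB≡) (suffixAB nB c₃ 0 c₃+nB≡ refl))
    where
    shuffle : ∀ a n f → a + (n + f) ≡ a + f + n
    shuffle = solve-∀
    c+f≡ : c + f ≡ nA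
    c+f≡ = final-window-covers-second c f nA nB c+e≡
    c≤nA : c ≤ nA
    c≤nA = m+n≤o⇒m≤o c (≤-reflexive c+f≡)
    a+f+nB≤ : a + f + nB ≤ nA
    a+f+nB≤ = ≤-trans (≤-reflexive (sym (shuffle a nB f))) a+e≤nA
    a+f≤ : a + f ≤ nA
    a+f≤ = m+n≤o⇒m≤o (a + f) a+f+nB≤
    combine : ∀ (x₁ pc pa s x₂ p₃ t : ℕ) → x₁ + pc ≤ pa + s → x₂ + p₃ ≤ x₁ + s → s + 0 ≤ p₃ + t →
      x₂ + pc ≤ pa + (s + t)
    combine x₁ pc pa s x₂ p₃ t h₁ h₂ h₃ =
      ≤-by-balance (+-mono-≤ (+-mono-≤ h₁ h₂) h₃) (solve (x₁ ∷ pc ∷ pa ∷ s ∷ x₂ ∷ p₃ ∷ t ∷ []))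

  -- A window inside B: FinalMaximal B shifted by sum A.
  finalMaximal-inside-B : ∀ a' e c → a' + e ≤ nB → c + e ≡ nA + nB →
    prefix (A ++ B) (nA + a' + e) + prefix (A ++ B) c ≤ prefix (A ++ B) (nA + a') + (sum A + sum B)
  finalMaximal-inside-B a' e c a'+e≤ c+e≡ with final-window-in-second c e nA nB c+e≡ (m+n≤o⇒n≤o a' a'+e≤)
  ... | c' , refl , c'+e≡ =
    ≤-cast (cong₂ _+_ (prefix-++ʳ A B (a' + e) (+-assoc nA a' e)) (prefix-++ʳ A B c' refl)) (cong (_+ _) (prefix-++ʳ A B a' refl))
      (shift (prefix B (a' + e)) (prefix B c') (prefix B a') (sum B) (sum A) (maxB a' e c' a'+e≤ c'+e≡))
    where
    shift : ∀ (x y z t s : ℕ) → x + y ≤ z + t → (s + x) + (s + y) ≤ (s + z) + (s + t)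
    shift x y z t s h = ≤-by-balance h (solve (x ∷ y ∷ z ∷ t ∷ s ∷ []))

  -- A window [a, nA + w) straddling the junction, with e₁ = nA ∸ a entries in A, whose
  -- final window lies in B: compare the A-part with a final window of B (SuffixBelow).
  finalMaximal-straddling-short : ∀ a e c w → a ≤ nA → a + e ≡ nA + w → e ≤ nB → c + e ≡ nA + nB →
    prefix (A ++ B) (a + e) + prefix (A ++ B) c ≤ prefix (A ++ B) a + (sum A + sum B)
  finalMaximal-straddling-short a e c w a≤nA a+e≡ e≤nB c+e≡ with final-window-in-second c e nA nB c+e≡ e≤nB
  ... | c' , refl , c'+e≡ =
    ≤-cast (cong₂ _+_ (prefix-++ʳ A B w a+e≡) (prefix-++ʳ A B c' refl)) (cong (_+ _) (prefix-++ˡ A B a a≤nA))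
      (combine (sum A) (prefix B (c' + w)) (prefix A a) (sum B) (prefix B w) (prefix B c')
        (suffixAB e₁ a (c' + w) a+e₁≡ c'+w+e₁≡) (minB c' w (m+n≤o⇒m≤o (c' + w) (≤-reflexive c'+w+e₁≡))))
    where
    e₁ : ℕ
    e₁ = nA ∸ a
    a+e₁≡ : a + e₁ ≡ nA
    a+e₁≡ = m+[n∸m]≡n a≤nA
    e≡ : e ≡ w + e₁
    e≡ = +-cancelˡ-≡ a _ _ (trans a+e≡ (trans (cong (_+ w) (sym a+e₁≡)) (shuffle a e₁ w)))
      where
      shuffle : ∀ a e w → a + e + w ≡ a + (w + e)
      shuffle = solve-∀
    c'+w+e₁≡ : c' + w + e₁ ≡ nB
    c'+w+e₁≡ = trans (+-assoc c' w e₁) (trans (cong (c' +_) (sym e≡)) c'+e≡)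
    combine : ∀ (s q pa t pw pc : ℕ) → s + q ≤ pa + t → pw + pc ≤ q → (s + pw) + (s + pc) ≤ pa + (s + t)
    combine s q pa t pw pc h₁ h₂ = ≤-by-balance (+-mono-≤ h₁ h₂) (solve (s ∷ q ∷ pa ∷ t ∷ pw ∷ pc ∷ []))
  -- A straddling window whose final window covers B: compare the B-part [nA, nA + w)
  -- with a final window of B.
  finalMaximal-straddling-long : ∀ a f c w → a ≤ nA → a + (nB + f) ≡ nA + w → w ≤ nB → c + (nB + f) ≡ nA + nB →
    prefix (A ++ B) (a + (nB + f)) + prefix (A ++ B) c ≤ prefix (A ++ B) a + (sum A + sum B)
  finalMaximal-straddling-long a f c w a≤nA a+e≡ w≤nB c+e≡ with complement w≤nB
  ... | g , g+w≡ =
    ≤-cast (cong₂ _+_ (prefix-++ʳ A B w a+e≡) (trans (prefix-++ˡ A B c c≤nA) (cong (prefix A) (sym a+g≡c))))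
      (cong (_+ _) (prefix-++ˡ A B a a≤nA))
      (combine (prefix A (a + g)) (prefix A c₄) (prefix A a) (sum A) (prefix B w) (sum B)
        (maxA a g c₄ a+g≤ c₄+g≡) (suffixAB g c₄ w c₄+g≡ (trans (+-comm w g) g+w≡)))
    where
    c+f≡ : c + f ≡ nA
    c+f≡ = final-window-covers-second c f nA nB c+e≡
    c≤nA : c ≤ nA
    c≤nA = m+n≤o⇒m≤o c (≤-reflexive c+f≡)
    a+g≡c : a + g ≡ c
    a+g≡c = +-cancelʳ-≡ f _ _ (+-cancelˡ-≡ w _ _ (begin
      w + (a + g + f)   ≡⟨ shuffle w a g f ⟩
      a + (g + w + f)   ≡⟨ cong (λ z → a + (z + f)) g+w≡ ⟩
      a + (nB + f)      ≡⟨ a+e≡ ⟩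
      nA + w            ≡⟨ cong (_+ w) c+f≡ ⟨
      c + f + w         ≡⟨ +-comm (c + f) w ⟩
      w + (c + f)       ∎))
      where
      open ≡-Reasoning
      shuffle : ∀ w a g f → w + (a + g + f) ≡ a + (g + w + f)
      shuffle = solve-∀
    a+g≤ : a + g ≤ nA
    a+g≤ = ≤-trans (≤-reflexive a+g≡c) c≤nA
    c₄ : ℕ
    c₄ = nA ∸ g
    c₄+g≡ : c₄ + g ≡ nA
    c₄+g≡ = m∸n+n≡m (m+n≤o⇒n≤o a a+g≤)
    combine : ∀ (x p₄ pa s pw t : ℕ) → x + p₄ ≤ pa + s → s + pw ≤ p₄ + t → (s + pw) + x ≤ pa + (s + t)
    combine x p₄ pa s pw t h₁ h₂ = ≤-by-balance (+-mono-≤ h₁ h₂) (solve (x ∷ p₄ ∷ pa ∷ s ∷ pw ∷ t ∷ []))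

  finalMaximal-++ : FinalMaximal (A ++ B)
  finalMaximal-++ a e c a+e≤ c+e≡ =
    ≤-cast refl (cong (prefix (A ++ B) a +_) (sum-++ A B)) (cases (≤-or-beyond (a + e) nA) (≤-or-beyond a nA))
    where
    c+e≡′ : c + e ≡ nA + nB
    c+e≡′ = trans c+e≡ length-AB
    a+e≤′ : a + e ≤ nA + nB
    a+e≤′ = ≤-trans a+e≤ (≤-reflexive length-AB)
    cases : a + e ≤ nA ⊎ (∃ λ w → a + e ≡ nA + w) → a ≤ nA ⊎ (∃ λ a' → a ≡ nA + a') →
      prefix (A ++ B) (a + e) + prefix (A ++ B) c ≤ prefix (A ++ B) a + (sum A + sum B)
    cases (inj₁ a+e≤nA) _ = finalMaximal-inside-A a e c a+e≤nA c+e≡′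
    cases (inj₂ _) (inj₂ (a' , refl)) =
      finalMaximal-inside-B a' e c (+-cancelˡ-≤ nA _ _ (≤-trans (≤-reflexive (sym (+-assoc nA a' e))) a+e≤′)) c+e≡′
    cases (inj₂ (w , a+e≡)) (inj₁ a≤nA) with ≤-or-beyond e nB
    ... | inj₁ e≤nB = finalMaximal-straddling-short a e c w a≤nA a+e≡ e≤nB c+e≡′
    ... | inj₂ (f , refl) =
      finalMaximal-straddling-long a f c w a≤nA a+e≡ (+-cancelˡ-≤ nA _ _ (≤-trans (≤-reflexive (sym a+e≡)) a+e≤′)) c+e≡′

-- Domination of A' ++ A by A ++ B, from the comparisons among the three lists A', A, B
-- (used with A' = colex (j+2) m, A = colex (j+1) m, B = colex j m).  The middle list is
-- at least as long as the shorter of its neighbours, by unimodality.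
module ConcatenationPair {A' A B : List ℕ}
  (middle-long : ∀ v → v ≤ length A' → v ≤ length B → v ≤ length A)
  (maxA' : FinalMaximal A') (prefixA'A : PrefixBelow A' A) (suffixA'A : SuffixBelow A' A)
  (minA : InitialMinimal A) (maxA : FinalMaximal A) (minB : InitialMinimal B)
  (prefixAB : PrefixBelow A B) (suffixAB : SuffixBelow A B) where

  nA' nA nB : ℕ
  nA' = length A'
  nA = length A
  nB = length B

  -- Initial windows [0, nA + v) of A ++ B with v ≤ nA': the first nA entries of A ++ B
  -- already dominate the corresponding window of A' (through its final window).
  prefixBelow-beyond-A : ∀ v → nA + v ≤ nA' → v ≤ nB →
    prefix (A' ++ A) (nA + v) ≤ prefix (A ++ B) (nA + v)
  prefixBelow-beyond-A v nA+v≤ v≤nB with complement (m+n≤o⇒n≤o v v+nA≤)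
    where
    v+nA≤ : v + nA ≤ nA'
    v+nA≤ = ≤-trans (≤-reflexive (+-comm v nA)) nA+v≤
  ... | c , c+nA≡ =
    ≤-cast (trans (prefix-++ˡ A' A (nA + v) nA+v≤) (cong (prefix A') (+-comm nA v))) (prefix-++ʳ A B v refl)
      (combine (prefix A' (v + nA)) (prefix A' c) (prefix A' v) (sum A') (sum A) (prefix A v) (prefix B v)
         (maxA' v nA c v+nA≤ c+nA≡) (suffixA'A nA c 0 c+nA≡ refl) (prefixA'A v v≤nA' v≤nA) (prefixAB v v≤nA v≤nB))
    where
    v+nA≤ : v + nA ≤ nA'
    v+nA≤ = ≤-trans (≤-reflexive (+-comm v nA)) nA+v≤
    v≤nA' : v ≤ nA'
    v≤nA' = m+n≤o⇒m≤o v v+nA≤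
    v≤nA : v ≤ nA
    v≤nA = middle-long v v≤nA' v≤nB
    combine : ∀ (x pc pv' s' sa pva pvb : ℕ) → x + pc ≤ pv' + s' → s' + 0 ≤ pc + sa → pv' ≤ pva → pva ≤ pvb →
      x ≤ sa + pvb
    combine x pc pv' s' sa pva pvb h₁ h₂ h₃ h₄ =
      ≤-by-balance (+-mono-≤ (+-mono-≤ (+-mono-≤ h₁ h₂) h₃) h₄) (solve (x ∷ pc ∷ pv' ∷ s' ∷ sa ∷ pva ∷ pvb ∷ []))

  -- Initial windows [0, nA' + u) inside A: all of A' is dominated by the first nA'
  -- entries of A, and the rest by minimality in A.
  prefixBelow-beyond-A' : ∀ u → nA' + u ≤ nA →
    prefix (A' ++ A) (nA' + u) ≤ prefix (A ++ B) (nA' + u)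
  prefixBelow-beyond-A' u nA'+u≤ =
    ≤-cast (prefix-++ʳ A' A u refl) (prefix-++ˡ A B (nA' + u) nA'+u≤)
      (combine (sum A') (prefix A nA') (prefix A u) (prefix A (nA' + u))
        (≤-cast (sym (prefix-all A')) refl (prefixA'A nA' ≤-refl (m+n≤o⇒m≤o nA' nA'+u≤))) (minA nA' u nA'+u≤))
    where
    combine : ∀ (s q pu r : ℕ) → s ≤ q → pu + q ≤ r → s + pu ≤ r
    combine s q pu r h₁ h₂ = ≤-by-balance (+-mono-≤ h₁ h₂) (solve (s ∷ q ∷ pu ∷ r ∷ []))

  -- Initial windows reaching past both A' and A: SuffixBelow A' A on the remainders.
  prefixBelow-beyond-both : ∀ u v → nA' + u ≡ nA + v → nA' + u ≤ nA' + nA → v ≤ nB →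
    prefix (A' ++ A) (nA' + u) ≤ prefix (A ++ B) (nA + v)
  prefixBelow-beyond-both u v nA'+u≡ e≤ v≤nB with complement v≤nA'
    where
    v≤nA' : v ≤ nA'
    v≤nA' = +-cancelˡ-≤ nA _ _ (≤-trans (≤-reflexive (sym nA'+u≡)) (≤-trans e≤ (≤-reflexive (+-comm nA' nA))))
  ... | s' , s'+v≡ =
    ≤-cast (prefix-++ʳ A' A u refl) (prefix-++ʳ A B v refl)
      (combine (sum A') (prefix A u) (prefix A' v) (sum A) (prefix A v) (prefix B v)
        (suffixA'A s' v u (trans (+-comm v s') s'+v≡) u+s'≡) (prefixA'A v v≤nA' v≤nA) (prefixAB v v≤nA v≤nB))
    where
    v≤nA' : v ≤ nA'
    v≤nA' = +-cancelˡ-≤ nA _ _ (≤-trans (≤-reflexive (sym nA'+u≡)) (≤-trans e≤ (≤-reflexive (+-comm nA' nA))))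
    v≤nA : v ≤ nA
    v≤nA = middle-long v v≤nA' v≤nB
    u+s'≡ : u + s' ≡ nA
    u+s'≡ = +-cancelʳ-≡ v _ _ (begin
      u + s' + v      ≡⟨ +-assoc u s' v ⟩
      u + (s' + v)    ≡⟨ cong (u +_) s'+v≡ ⟩
      u + nA'         ≡⟨ +-comm u nA' ⟩
      nA' + u         ≡⟨ nA'+u≡ ⟩
      nA + v          ∎)
      where open ≡-Reasoning
    combine : ∀ (s' pu pv' sa pva pvb : ℕ) → s' + pu ≤ pv' + sa → pv' ≤ pva → pva ≤ pvb → s' + pu ≤ sa + pvb
    combine s' pu pv' sa pva pvb h₁ h₂ h₃ =
      ≤-by-balance (+-mono-≤ (+-mono-≤ h₁ h₂) h₃) (solve (s' ∷ pu ∷ pv' ∷ sa ∷ pva ∷ pvb ∷ []))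

  prefixBelow-++ : PrefixBelow (A' ++ A) (A ++ B)
  prefixBelow-++ e e≤ e≤′ with ≤-or-beyond e nA' | ≤-or-beyond e nA
  ... | inj₁ e≤nA' | inj₁ e≤nA =
    ≤-cast (prefix-++ˡ A' A e e≤nA') (prefix-++ˡ A B e e≤nA) (prefixA'A e e≤nA' e≤nA)
  ... | inj₁ e≤nA' | inj₂ (v , refl) =
    prefixBelow-beyond-A v e≤nA' (+-cancelˡ-≤ nA _ _ (≤-trans e≤′ (≤-reflexive (length-++ A))))
  ... | inj₂ (u , refl) | inj₁ e≤nA = prefixBelow-beyond-A' u e≤nA
  ... | inj₂ (u , refl) | inj₂ (v , nA'+u≡) =
    ≤-cast refl (cong (prefix (A ++ B)) nA'+u≡)
      (prefixBelow-beyond-both u v nA'+u≡ (≤-trans e≤ (≤-reflexive (length-++ A')))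
        (+-cancelˡ-≤ nA _ _ (≤-trans (≤-reflexive (sym nA'+u≡)) (≤-trans e≤′ (≤-reflexive (length-++ A))))))

  suffixBelow-short : ∀ c₁' c₂' e → c₁' + e ≡ nA → c₂' + e ≡ nB →
    (sum A' + sum A) + prefix (A ++ B) (nA + c₂') ≤ prefix (A' ++ A) (nA' + c₁') + (sum A + sum B)
  suffixBelow-short c₁' c₂' e c₁'+e≡ c₂'+e≡ =
    ≤-cast (cong (_ +_) (prefix-++ʳ A B c₂' refl)) (cong (_+ _) (prefix-++ʳ A' A c₁' refl))
      (shift (sum A) (prefix B c₂') (prefix A c₁') (sum B) (sum A') (suffixAB e c₁' c₂' c₁'+e≡ c₂'+e≡))
    where
    shift : ∀ (s q p t s' : ℕ) → s + q ≤ p + t → (s' + s) + (s + q) ≤ (s' + p) + (s + t)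
    shift s q p t s' h = ≤-by-balance h (solve (s ∷ q ∷ p ∷ t ∷ s' ∷ []))

  -- The window covers B but not A: split the final window of A at length nB.
  suffixBelow-covers-B : ∀ c₁' c₂ g → c₁' + nB + g ≡ nA → c₂ + g ≡ nA →
    (sum A' + sum A) + prefix (A ++ B) c₂ ≤ prefix (A' ++ A) (nA' + c₁') + (sum A + sum B)
  suffixBelow-covers-B c₁' c₂ g c₁'+nB+g≡ c₂+g≡ with complement (m+n≤o⇒n≤o c₁' (m+n≤o⇒m≤o (c₁' + nB) (≤-reflexive c₁'+nB+g≡)))
  ... | c₃ , c₃+nB≡ =
    ≤-cast (cong (_ +_) (trans (prefix-++ˡ A B c₂ c₂≤nA) (cong (prefix A) (sym c₁'+nB≡c₂)))) (cong (_+ _) (prefix-++ʳ A' A c₁' refl))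
      (combine (prefix A (c₁' + nB)) (prefix A c₃) (prefix A c₁') (sum A) (sum B) (sum A')
        (maxA c₁' nB c₃ (≤-trans (≤-reflexive c₁'+nB≡c₂) c₂≤nA) c₃+nB≡) (suffixAB nB c₃ 0 c₃+nB≡ refl))
    where
    c₂≤nA : c₂ ≤ nA
    c₂≤nA = m+n≤o⇒m≤o c₂ (≤-reflexive c₂+g≡)
    c₁'+nB≡c₂ : c₁' + nB ≡ c₂
    c₁'+nB≡c₂ = +-cancelʳ-≡ g _ _ (trans c₁'+nB+g≡ (sym c₂+g≡))
    combine : ∀ (x p₃ p₁ s t s' : ℕ) → x + p₃ ≤ p₁ + s → s + 0 ≤ p₃ + t → (s' + s) + x ≤ (s' + p₁) + (s + t)
    combine x p₃ p₁ s t s' h₁ h₂ = ≤-by-balance (+-mono-≤ h₁ h₂) (solve (x ∷ p₃ ∷ p₁ ∷ s ∷ t ∷ s' ∷ []))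

  -- The window covers A but not B: compare through the first nA entries of B.
  suffixBelow-covers-A : ∀ c₁ c₂' f → c₁ + f ≡ nA' → c₂' + nA + f ≡ nB → f ≤ nA →
    (sum A' + sum A) + prefix (A ++ B) (nA + c₂') ≤ prefix (A' ++ A) c₁ + (sum A + sum B)
  suffixBelow-covers-A c₁ c₂' f c₁+f≡ c₂'+nA+f≡ f≤nA with complement f≤nA
  ... | c₂'' , c₂''+f≡ =
    ≤-cast (cong (_ +_) (prefix-++ʳ A B c₂' refl)) (cong (_+ _) (prefix-++ˡ A' A c₁ (m+n≤o⇒m≤o c₁ (≤-reflexive c₁+f≡))))
      (combine (sum A') (prefix A c₂'') (prefix A' c₁) (sum A) (prefix B (c₂' + nA)) (sum B) (prefix B nA) (prefix B c₂')
        (suffixA'A f c₁ c₂'' c₁+f≡ c₂''+f≡) (suffixAB f c₂'' (c₂' + nA) c₂''+f≡ c₂'+nA+f≡)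
        (≤-cast (sym (prefix-all A)) refl (prefixAB nA ≤-refl nA≤nB)) (minB c₂' nA c₂'+nA≤))
    where
    c₂'+nA≤ : c₂' + nA ≤ nB
    c₂'+nA≤ = m+n≤o⇒m≤o (c₂' + nA) (≤-reflexive c₂'+nA+f≡)
    nA≤nB : nA ≤ nB
    nA≤nB = m+n≤o⇒n≤o c₂' c₂'+nA≤
    combine : ∀ (sA' p₂ q₁ sA r sB pn pc : ℕ) → sA' + p₂ ≤ q₁ + sA → sA + r ≤ p₂ + sB → sA ≤ pn → pn + pc ≤ r →
      (sA' + sA) + (sA + pc) ≤ q₁ + (sA + sB)
    combine sA' p₂ q₁ sA r sB pn pc h₁ h₂ h₃ h₄ =
      ≤-by-balance (+-mono-≤ (+-mono-≤ (+-mono-≤ h₁ h₂) h₃) h₄) (solve (sA' ∷ p₂ ∷ q₁ ∷ sA ∷ r ∷ sB ∷ pn ∷ pc ∷ []))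

  -- The window covers both A and B: compare the remainders through A.
  suffixBelow-covers-both : ∀ c₁ c₂ f → c₁ + f ≡ nA' → c₂ + f ≡ nB → c₂ ≤ nA → f ≤ nA →
    (sum A' + sum A) + prefix (A ++ B) c₂ ≤ prefix (A' ++ A) c₁ + (sum A + sum B)
  suffixBelow-covers-both c₁ c₂ f c₁+f≡ c₂+f≡ c₂≤nA f≤nA with complement f≤nA
  ... | c₃ , c₃+f≡ =
    ≤-cast (cong (_ +_) (prefix-++ˡ A B c₂ c₂≤nA)) (cong (_+ _) (prefix-++ˡ A' A c₁ (m+n≤o⇒m≤o c₁ (≤-reflexive c₁+f≡))))
      (combine (sum A') (prefix A c₃) (prefix A' c₁) (sum A) (prefix B c₂) (sum B) (prefix A c₂)
        (suffixA'A f c₁ c₃ c₁+f≡ c₃+f≡) (suffixAB f c₃ c₂ c₃+f≡ c₂+f≡) (prefixAB c₂ c₂≤nA (m+n≤o⇒m≤o c₂ (≤-reflexive c₂+f≡))))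
    where
    combine : ∀ (sA' p₃ q₁ sA pb sB pa : ℕ) → sA' + p₃ ≤ q₁ + sA → sA + pb ≤ p₃ + sB → pa ≤ pb →
      (sA' + sA) + pa ≤ q₁ + (sA + sB)
    combine sA' p₃ q₁ sA pb sB pa h₁ h₂ h₃ =
      ≤-by-balance (+-mono-≤ (+-mono-≤ h₁ h₂) h₃) (solve (sA' ∷ p₃ ∷ q₁ ∷ sA ∷ pb ∷ sB ∷ pa ∷ []))

  suffixBelow-++ : SuffixBelow (A' ++ A) (A ++ B)
  suffixBelow-++ e c₁ c₂ c₁+e≡ c₂+e≡ =
    ≤-cast (cong (_+ _) (sum-++ A' A)) (cong (_ +_) (sum-++ A B)) (cases (≤-or-beyond e nA) (≤-or-beyond e nB))
    where
    c₁+e≡′ : c₁ + e ≡ nA' + nA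
    c₁+e≡′ = trans c₁+e≡ (length-++ A')
    c₂+e≡′ : c₂ + e ≡ nA + nB
    c₂+e≡′ = trans c₂+e≡ (length-++ A)
    cases : e ≤ nA ⊎ (∃ λ f → e ≡ nA + f) → e ≤ nB ⊎ (∃ λ g → e ≡ nB + g) →
      (sum A' + sum A) + prefix (A ++ B) c₂ ≤ prefix (A' ++ A) c₁ + (sum A + sum B)
    cases (inj₁ e≤nA) (inj₁ e≤nB)
      with final-window-in-second c₁ e nA' nA c₁+e≡′ e≤nA | final-window-in-second c₂ e nA nB c₂+e≡′ e≤nB
    ... | c₁' , refl , c₁'+e≡ | c₂' , refl , c₂'+e≡ = suffixBelow-short c₁' c₂' e c₁'+e≡ c₂'+e≡
    cases (inj₁ e≤nA) (inj₂ (g , refl)) with final-window-in-second c₁ e nA' nA c₁+e≡′ e≤nA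
    ... | c₁' , refl , c₁'+e≡ =
      suffixBelow-covers-B c₁' c₂ g (trans (+-assoc c₁' nB g) c₁'+e≡) (final-window-covers-second c₂ g nA nB c₂+e≡′)
    cases (inj₂ (f , refl)) (inj₁ e≤nB) with final-window-in-second c₂ e nA nB c₂+e≡′ e≤nB
    ... | c₂' , refl , c₂'+e≡ =
      suffixBelow-covers-A c₁ c₂' f c₁+f≡ (trans (+-assoc c₂' nA f) c₂'+e≡)
        (middle-long f (m+n≤o⇒n≤o c₁ (≤-reflexive c₁+f≡)) (m+n≤o⇒n≤o nA e≤nB))
      where
      c₁+f≡ : c₁ + f ≡ nA'
      c₁+f≡ = final-window-covers-second c₁ f nA' nA c₁+e≡′
    cases (inj₂ (f , refl)) (inj₂ (g , nA+f≡nB+g)) =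
      suffixBelow-covers-both c₁ c₂ f c₁+f≡ c₂+f≡ (m+n≤o⇒m≤o c₂ (≤-reflexive c₂+g≡))
        (middle-long f (m+n≤o⇒n≤o c₁ (≤-reflexive c₁+f≡)) (m+n≤o⇒n≤o c₂ (≤-reflexive c₂+f≡)))
      where
      c₁+f≡ : c₁ + f ≡ nA'
      c₁+f≡ = final-window-covers-second c₁ f nA' nA c₁+e≡′
      c₂+g≡ : c₂ + g ≡ nA
      c₂+g≡ = final-window-covers-second c₂ g nA nB (trans (cong (c₂ +_) (sym nA+f≡nB+g)) c₂+e≡′)
      c₂+f≡ : c₂ + f ≡ nB
      c₂+f≡ = +-cancelʳ-≡ nA _ _ (begin
        c₂ + f + nA     ≡⟨ +-assoc c₂ f nA ⟩
        c₂ + (f + nA)   ≡⟨ cong (c₂ +_) (+-comm f nA) ⟩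
        c₂ + (nA + f)   ≡⟨ c₂+e≡′ ⟩
        nA + nB         ≡⟨ +-comm nA nB ⟩
        nB + nA         ∎)
        where open ≡-Reasoning

-- colex j m lists min S (with min ∅ = m) over the j-subsets S of {0,…,m-1} in
-- colexicographic order; in colex (j+1) (m+1) the sets avoiding m come first.
colex : ℕ → ℕ → List ℕ
colex zero m = m ∷ []
colex (suc j) zero = []
colex (suc j) (suc m) = colex (suc j) m ++ colex j m

colex-length : ∀ j m → length (colex j m) ≡ binom m j
colex-length zero m = refl
colex-length (suc j) zero = refl
colex-length (suc j) (suc m) =
  trans (length-++ (colex (suc j) m)) (cong₂ _+_ (colex-length (suc j) m) (colex-length j m))

-- Each (j+1)-set T is counted once, at the j-set T ∖ {min T}.
colex-sum : ∀ j m → sum (colex j m) ≡ binom m (suc j)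
colex-sum zero m = trans (+-identityʳ m) (sym (binom-1 m))
colex-sum (suc j) zero = refl
colex-sum (suc j) (suc m) =
  trans (sum-++ (colex (suc j) m) (colex j m)) (cong₂ _+_ (colex-sum (suc j) m) (colex-sum j m))

initialMinimal-[] : InitialMinimal []
initialMinimal-[] zero zero _ = ≤-refl

initialMinimal-[_] : ∀ x → InitialMinimal (x ∷ [])
initialMinimal-[ x ] zero e _ = ≤-reflexive (+-identityʳ _)
initialMinimal-[ x ] (suc zero) zero _ = ≤-refl
initialMinimal-[ x ] (suc zero) (suc e) (s≤s ())
initialMinimal-[ x ] (suc (suc a)) e (s≤s ())

finalMaximal-[] : FinalMaximal []
finalMaximal-[] zero zero zero _ _ = ≤-refl

finalMaximal-[_] : ∀ x → FinalMaximal (x ∷ [])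
finalMaximal-[ x ] zero zero (suc zero) _ _ = ≤-refl
finalMaximal-[ x ] zero (suc zero) zero _ _ = ≤-reflexive (+-identityʳ _)
finalMaximal-[ x ] zero (suc zero) (suc c) _ eq = ⊥-elim (m+1+n≢0 c (cong pred eq))
finalMaximal-[ x ] zero (suc (suc e)) c (s≤s ()) _
finalMaximal-[ x ] (suc zero) zero (suc zero) _ _ = ≤-refl
finalMaximal-[ x ] (suc zero) (suc e) c (s≤s ()) _
finalMaximal-[ x ] (suc (suc a)) e c (s≤s ()) _

prefixBelow-[] : ∀ ys → PrefixBelow [] ys
prefixBelow-[] ys zero _ _ = z≤n

suffixBelow-[] : ∀ ys → SuffixBelow [] ys
suffixBelow-[] ys zero zero c₂ _ c₂+0≡ =
  ≤-reflexive (trans (cong (prefix ys) (trans (sym (+-identityʳ c₂)) c₂+0≡)) (prefix-all ys))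
suffixBelow-[] ys (suc e) c₁ c₂ c₁+e≡0 _ = ⊥-elim (m+1+n≢0 c₁ c₁+e≡0)

-- colex 1 (m+1) = 0, 1, …, m is dominated by colex 0 (m+1) = m+1: its first entry is 0 ...
colex-1-first : ∀ m → prefix (colex 1 (suc m)) 1 ≡ 0
colex-1-first zero = refl
colex-1-first (suc m) =
  trans (prefix-++ˡ (colex 1 (suc m)) (colex 0 (suc m)) 1 one≤) (colex-1-first m)
  where
  one≤ : 1 ≤ length (colex 1 (suc m))
  one≤ = ≤-trans (s≤s z≤n) (≤-reflexive (sym (trans (colex-length 1 (suc m)) (binom-1 (suc m)))))

prefixBelow-colex-1 : ∀ m → PrefixBelow (colex 1 (suc m)) (colex 0 (suc m))
prefixBelow-colex-1 m zero _ _ = z≤n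
prefixBelow-colex-1 m (suc zero) _ _ = ≤-trans (≤-reflexive (colex-1-first m)) z≤n
prefixBelow-colex-1 m (suc (suc e)) _ (s≤s ())

-- ... and its last entry is m.
suffixBelow-colex-1 : ∀ m → SuffixBelow (colex 1 (suc m)) (colex 0 (suc m))
suffixBelow-colex-1 m zero c₁ (suc zero) c₁+0≡ _ =
  ≤-reflexive (cong (λ z → z + (suc m + 0)) (trans (sym (prefix-all (colex 1 (suc m)))) (cong (prefix (colex 1 (suc m))) (trans (sym c₁+0≡) (+-identityʳ c₁)))))
suffixBelow-colex-1 m (suc zero) c₁ zero c₁+1≡ _ = ≤-cast all≡ prefix≡ (m≤m+n (sum (colex 1 m) + m) 1)
  where
  c₁≡ : c₁ ≡ length (colex 1 m)
  c₁≡ = +-cancelʳ-≡ 1 _ _ (trans c₁+1≡ (length-++ (colex 1 m)))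
  all≡ : sum (colex 1 m ++ m ∷ []) + 0 ≡ sum (colex 1 m) + m
  all≡ = trans (+-identityʳ _) (trans (sum-++ (colex 1 m) (m ∷ [])) (cong (sum (colex 1 m) +_) (+-identityʳ m)))
  prefix≡ : prefix (colex 1 m ++ m ∷ []) c₁ + (suc m + 0) ≡ sum (colex 1 m) + m + 1
  prefix≡ = trans (cong₂ _+_ (trans (cong (prefix (colex 1 m ++ m ∷ [])) c₁≡)
                    (trans (prefix-++ˡ (colex 1 m) (m ∷ []) _ ≤-refl) (prefix-all (colex 1 m)))) (+-identityʳ (suc m)))
            (shuffle (sum (colex 1 m)) m)
    where
    shuffle : ∀ s m → s + suc m ≡ s + m + 1
    shuffle = solve-∀
suffixBelow-colex-1 m (suc zero) c₁ (suc c₂) _ c₂+1≡1 = ⊥-elim (m+1+n≢0 c₂ (cong pred c₂+1≡1))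
suffixBelow-colex-1 m (suc (suc e)) c₁ c₂ _ c₂+e≡1 =
  ⊥-elim (m+1+n≢0 c₂ (cong pred (trans (sym (+-suc c₂ (suc e))) c₂+e≡1)))

record ColexFacts (j m : ℕ) : Set where
  field
    initialMinimal : InitialMinimal (colex j m)
    finalMaximal   : FinalMaximal (colex j m)
    prefixBelow    : PrefixBelow (colex (suc j) m) (colex j m)
    suffixBelow    : SuffixBelow (colex (suc j) m) (colex j m)

open ColexFacts

-- Proved by induction on m along the Pascal recursion of colex, using the concatenation
-- lemmas; the middle-length condition is unimodality of (m choose ·).
colex-facts : ∀ m j → ColexFacts j m
colex-facts zero zero =
  record { initialMinimal = initialMinimal-[ 0 ] ; finalMaximal = finalMaximal-[ 0 ]
         ; prefixBelow = prefixBelow-[] _ ; suffixBelow = suffixBelow-[] _ }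
colex-facts zero (suc j) =
  record { initialMinimal = initialMinimal-[] ; finalMaximal = finalMaximal-[]
         ; prefixBelow = prefixBelow-[] _ ; suffixBelow = suffixBelow-[] _ }
colex-facts (suc m) zero =
  record { initialMinimal = initialMinimal-[ suc m ] ; finalMaximal = finalMaximal-[ suc m ]
         ; prefixBelow = prefixBelow-colex-1 m ; suffixBelow = suffixBelow-colex-1 m }
colex-facts (suc m) (suc j) = record
  { initialMinimal = Concatenation.initialMinimal-++ minA maxA minB maxB prefixAB suffixAB
  ; finalMaximal = Concatenation.finalMaximal-++ minA maxA minB maxB prefixAB suffixAB
  ; prefixBelow = ConcatenationPair.prefixBelow-++ middle-long maxA' prefixA'A suffixA'A minA maxA minB prefixAB suffixAB
  ; suffixBelow = ConcatenationPair.suffixBelow-++ middle-long maxA' prefixA'A suffixA'A minA maxA minB prefixAB suffixAB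
  }
  where
  A' A B : List ℕ
  A' = colex (suc (suc j)) m
  A = colex (suc j) m
  B = colex j m
  minA : InitialMinimal A
  minA = initialMinimal (colex-facts m (suc j))
  maxA : FinalMaximal A
  maxA = finalMaximal (colex-facts m (suc j))
  prefixA'A : PrefixBelow A' A
  prefixA'A = prefixBelow (colex-facts m (suc j))
  suffixA'A : SuffixBelow A' A
  suffixA'A = suffixBelow (colex-facts m (suc j))
  minB : InitialMinimal B
  minB = initialMinimal (colex-facts m j)
  maxB : FinalMaximal B
  maxB = finalMaximal (colex-facts m j)
  prefixAB : PrefixBelow A B
  prefixAB = prefixBelow (colex-facts m j)
  suffixAB : SuffixBelow A B
  suffixAB = suffixBelow (colex-facts m j)
  maxA' : FinalMaximal A'
  maxA' = finalMaximal (colex-facts m (suc (suc j)))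
  middle-long : ∀ v → v ≤ length A' → v ≤ length B → v ≤ length A
  middle-long v v≤A' v≤B = ≤-trans
    (binom-unimodal m j v (≤-trans v≤B (≤-reflexive (colex-length j m))) (≤-trans v≤A' (≤-reflexive (colex-length (suc (suc j)) m))))
    (≤-reflexive (sym (colex-length (suc j) m)))

-- shadow k m x is the size of the shadow of the first x k-subsets of {0,…,m-1} in
-- colex order; for x = Σᵢ (aᵢ choose k-i) it is Σᵢ (aᵢ choose k-1-i).
shadow : ℕ → ℕ → ℕ → ℕ
shadow zero m x = 0
shadow (suc j) zero x = 0
shadow (suc j) (suc m) x with x ≤? binom m (suc j)
... | yes _ = shadow (suc j) m x
... | no _ = binom m j + shadow j m (x ∸ binom m (suc j))

-- The two branches of the recursion: sets avoiding m, and sets containing m.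
shadow-low : ∀ j m x → x ≤ binom m (suc j) → shadow (suc j) (suc m) x ≡ shadow (suc j) m x
shadow-low j m x x≤ with x ≤? binom m (suc j)
... | yes _ = refl
... | no x≰ = ⊥-elim (x≰ x≤)

shadow-high : ∀ j m t → shadow (suc j) (suc m) (binom m (suc j) + suc t) ≡ binom m j + shadow j m (suc t)
shadow-high j m t with (binom m (suc j) + suc t) ≤? binom m (suc j)
... | yes x≤ = ⊥-elim (<⇒≱ (m<m+n (binom m (suc j)) (s≤s z≤n)) x≤)
... | no _ = cong (λ z → binom m j + shadow j m z) (m+n∸m≡n (binom m (suc j)) (suc t))

shadow-zero : ∀ j m → shadow j m 0 ≡ 0
shadow-zero zero m = refl
shadow-zero (suc j) zero = refl
shadow-zero (suc j) (suc m) = trans (shadow-low j m 0 z≤n) (shadow-zero (suc j) m)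

-- Shadows of (j+1)-sets of {0,…,m-1} are j-sets of {0,…,m-1}.
shadow-bound : ∀ K m q → q ≤ binom m (suc K) → shadow (suc K) m q ≤ binom m K
shadow-bound K zero q _ = z≤n
shadow-bound K (suc m) q q≤ with ≤-or-strictly-beyond q (binom m (suc K))
... | inj₁ q≤C =
  ≤-trans (≤-reflexive (shadow-low K m q q≤C)) (≤-trans (shadow-bound K m q q≤C) (binom-mono-step m K))
... | inj₂ (t , refl) = ≤-trans (≤-reflexive (shadow-high K m t)) (high K (+-cancelˡ-≤ (binom m (suc K)) _ _ q≤))
  where
  high : ∀ K → suc t ≤ binom m K → binom m K + shadow K m (suc t) ≤ binom (suc m) K
  high zero _ = ≤-refl
  high (suc K') t< = +-monoʳ-≤ (binom m (suc K')) (shadow-bound K' m (suc t) t<)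

shadow-full : ∀ K m → suc K ≤ m → shadow (suc K) m (binom m (suc K)) ≡ binom m K
shadow-full K (suc m) (s≤s K≤m) with binom-positive m K K≤m
... | t , C≡ = begin
  shadow (suc K) (suc m) (binom m (suc K) + binom m K) ≡⟨ cong (λ z → shadow (suc K) (suc m) (binom m (suc K) + z)) C≡ ⟩
  shadow (suc K) (suc m) (binom m (suc K) + suc t)     ≡⟨ shadow-high K m t ⟩
  binom m K + shadow K m (suc t)                       ≡⟨ cong (λ z → binom m K + shadow K m z) (sym C≡) ⟩
  binom m K + shadow K m (binom m K)                   ≡⟨ full K K≤m ⟩
  binom (suc m) K                                      ∎
  where
  open ≡-Reasoning
  full : ∀ K → K ≤ m → binom m K + shadow K m (binom m K) ≡ binom (suc m) K
  full zero _ = refl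
  full (suc K') K'<m = cong (binom m (suc K') +_) (shadow-full K' m K'<m)

shadow-high′ : ∀ K m v → suc K ≤ m →
  shadow (suc K) (suc m) (binom m (suc K) + v) ≡ binom m K + shadow K m v
shadow-high′ K m zero K<m = begin
  shadow (suc K) (suc m) (binom m (suc K) + 0) ≡⟨ shadow-low K m _ (≤-reflexive (+-identityʳ _)) ⟩
  shadow (suc K) m (binom m (suc K) + 0)       ≡⟨ cong (shadow (suc K) m) (+-identityʳ _) ⟩
  shadow (suc K) m (binom m (suc K))           ≡⟨ shadow-full K m K<m ⟩
  binom m K                                    ≡⟨ +-identityʳ _ ⟨
  binom m K + 0                                ≡⟨ cong (binom m K +_) (shadow-zero K m) ⟨
  binom m K + shadow K m 0                     ∎
  where open ≡-Reasoning
shadow-high′ K m (suc t) _ = shadow-high K m t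

prefix-ground-step : ∀ J m x → x ≤ binom m (suc J) → prefix (colex (suc J) (suc m)) x ≡ prefix (colex (suc J) m) x
prefix-ground-step J m x x≤ =
  prefix-++ˡ (colex (suc J) m) (colex J m) x (≤-trans x≤ (≤-reflexive (sym (colex-length (suc J) m))))

prefix-ground : ∀ J m d x → x ≤ binom m (suc J) → prefix (colex (suc J) m) x ≡ prefix (colex (suc J) (m + d)) x
prefix-ground J m zero x x≤ = cong (λ z → prefix (colex (suc J) z) x) (sym (+-identityʳ m))
prefix-ground J m (suc d) x x≤ = trans (prefix-ground J m d x x≤)
  (trans (sym (prefix-ground-step J (m + d) x (≤-trans x≤ (binom-mono m d (suc J)))))
    (cong (λ z → prefix (colex (suc J) z) x) (sym (+-suc m d))))

shadow-ground-step : ∀ J m x → x ≤ binom m J → shadow J (suc m) x ≡ shadow J m x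
shadow-ground-step zero m x _ = refl
shadow-ground-step (suc J) m x x≤ = shadow-low J m x x≤

shadow-ground : ∀ J m d x → x ≤ binom m J → shadow J m x ≡ shadow J (m + d) x
shadow-ground J m zero x x≤ = cong (λ z → shadow J z x) (sym (+-identityʳ m))
shadow-ground J m (suc d) x x≤ = trans (shadow-ground J m d x x≤)
  (trans (sym (shadow-ground-step J (m + d) x (≤-trans x≤ (binom-mono m d J))))
    (cong (λ z → shadow J z x) (sym (+-suc m d))))

prefix-ground-mono : ∀ J m x → x ≤ binom m J → prefix (colex J m) x ≤ prefix (colex J (suc m)) x
prefix-ground-mono zero m zero _ = ≤-refl
prefix-ground-mono zero m (suc zero) _ = +-monoˡ-≤ 0 (n≤1+n m)
prefix-ground-mono zero m (suc (suc x)) (s≤s ())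
prefix-ground-mono (suc J) m x x≤ = ≤-reflexive (sym (prefix-ground-step J m x x≤))

-- The entries over the shadow of the first q (K+1)-sets add up to at least q: each of
-- these sets T is counted at the K-set T ∖ {min T}, which lies in the shadow.
shadow-covers : ∀ K m q → q ≤ binom m (suc K) → q ≤ prefix (colex K m) (shadow (suc K) m q)
shadow-covers K zero zero _ = z≤n
shadow-covers K (suc m) q q≤ with ≤-or-strictly-beyond q (binom m (suc K))
... | inj₁ q≤C = ≤-trans (shadow-covers K m q q≤C)
  (≤-trans (prefix-ground-mono K m _ (shadow-bound K m q q≤C))
    (≤-reflexive (cong (prefix (colex K (suc m))) (sym (shadow-low K m q q≤C)))))
... | inj₂ (t , refl) =
  ≤-trans (high K (+-cancelˡ-≤ (binom m (suc K)) _ _ q≤)) (≤-reflexive (cong (prefix (colex K (suc m))) (sym (shadow-high K m t))))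
  where
  high : ∀ K → suc t ≤ binom m K →
    binom m (suc K) + suc t ≤ prefix (colex K (suc m)) (binom m K + shadow K m (suc t))
  high zero (s≤s z≤n) =
    ≤-reflexive (trans (cong (_+ 1) (binom-1 m)) (trans (+-comm m 1) (sym (+-identityʳ (suc m)))))
  high (suc K') t< = ≤-trans
    (+-mono-≤ (≤-reflexive (sym (colex-sum (suc K') m))) (shadow-covers K' m (suc t) t<))
    (≤-reflexive (sym (prefix-++ʳ (colex (suc K') m) (colex K' m) (shadow (suc K') m (suc t))
      (cong (_+ shadow (suc K') m (suc t)) (sym (colex-length (suc K') m))))))

-- Writing Q for the shadow of q, the shadow
-- of q inside {0,…,m} is again Q, and the q sets weigh at most prefix B Q, B = colex K m.
main-second-block-fits : ∀ K m r q → q ≤ binom m (suc K) → r + shadow (suc K) m q ≤ binom m K →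
  prefix (colex (suc K) (suc m)) (binom m (suc K) + r) + q
    ≤ prefix (colex (suc K) (suc (suc m))) (binom m (suc K) + r + shadow (suc K) (suc m) q)
main-second-block-fits K m r q q≤C r+Q≤ =
  ≤-cast (cong (_+ q) (prefix-++ʳ A B r (cong (_+ r) (sym (colex-length (suc K) m)))))
    (begin-equality
      prefix (colex (suc K) (suc (suc m))) (F + r + shadow (suc K) (suc m) q)
        ≡⟨ cong (λ z → prefix (colex (suc K) (suc (suc m))) (F + r + z)) (shadow-low K m q q≤C) ⟩
      prefix (colex (suc K) (suc (suc m))) (F + r + Q)
        ≡⟨ cong (prefix (colex (suc K) (suc (suc m)))) (+-assoc F r Q) ⟩
      prefix (colex (suc K) (suc (suc m))) (F + (r + Q))
        ≡⟨ prefix-ground-step K (suc m) _ (+-monoʳ-≤ F r+Q≤) ⟩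
      prefix (A ++ B) (F + (r + Q))
        ≡⟨ prefix-++ʳ A B (r + Q) (cong (_+ (r + Q)) (sym (colex-length (suc K) m))) ⟩
      sum A + prefix B (r + Q) ∎)
    (combine q (prefix B Q) (prefix B r) (prefix B (r + Q)) (sum A) (shadow-covers K m q q≤C)
      (initialMinimal (colex-facts m K) r Q (≤-trans r+Q≤ (≤-reflexive (sym (colex-length K m))))))
  where
  open ≤-Reasoning
  F : ℕ
  F = binom m (suc K)
  A B : List ℕ
  A = colex (suc K) m
  B = colex K m
  Q : ℕ
  Q = shadow (suc K) m q
  combine : ∀ (q pQ pr prq s : ℕ) → q ≤ pQ → pQ + pr ≤ prq → (s + pr) + q ≤ s + prq
  combine q pQ pr prq s h₁ h₂ = ≤-by-balance (+-mono-≤ h₁ h₂) (solve (q ∷ pQ ∷ pr ∷ prq ∷ s ∷ []))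

main-second-block-overflows : ∀ K m r q z → q ≤ binom m (suc K) → r ≤ binom m K →
  r + shadow (suc K) m q ≡ binom m K + z →
  prefix (colex (suc K) (suc m)) (binom m (suc K) + r) + q
    ≤ prefix (colex (suc K) (suc (suc m))) (binom m (suc K) + r + shadow (suc K) (suc m) q)
main-second-block-overflows K m r q z q≤C r≤ r+Q≡ with complement r≤
... | e₀ , e₀+r≡ =
  ≤-cast (cong (_+ q) (prefix-++ʳ A B r (cong (_+ r) (sym (colex-length (suc K) m)))))
    (begin-equality
      prefix (colex (suc K) (suc (suc m))) (F + r + shadow (suc K) (suc m) q)
        ≡⟨ cong (λ y → prefix (colex (suc K) (suc (suc m))) (F + r + y)) (shadow-low K m q q≤C) ⟩
      prefix (colex (suc K) (suc (suc m))) (F + r + Q)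
        ≡⟨ cong (prefix (colex (suc K) (suc (suc m)))) (trans (+-assoc F r Q) (trans (cong (F +_) r+Q≡) (sym (+-assoc F G z)))) ⟩
      prefix (colex (suc K) (suc m) ++ colex K (suc m)) (F + G + z)
        ≡⟨ prefix-++ʳ (colex (suc K) (suc m)) (colex K (suc m)) z (cong (_+ z) (sym (colex-length (suc K) (suc m)))) ⟩
      sum (A ++ B) + prefix (colex K (suc m)) z
        ≡⟨ cong (_+ prefix (colex K (suc m)) z) (sum-++ A B) ⟩
      (sum A + sum B) + prefix (colex K (suc m)) z ∎)
    (combine q (prefix B Q) (prefix B r) (prefix B z) (sum B) (prefix (colex K (suc m)) z) (sum A)
      (shadow-covers K m q q≤C) window (prefix-ground-mono K m z z≤D))
  where
  open ≤-Reasoning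
  F G Q : ℕ
  F = binom m (suc K)
  G = binom m K
  Q = shadow (suc K) m q
  A B : List ℕ
  A = colex (suc K) m
  B = colex K m
  z+e₀≡Q : z + e₀ ≡ Q
  z+e₀≡Q = +-cancelˡ-≡ r _ _ (trans (shuffle r z e₀) (trans (cong (_+ z) e₀+r≡) (sym r+Q≡)))
    where
    shuffle : ∀ r z e → r + (z + e) ≡ e + r + z
    shuffle = solve-∀
  z≤D : z ≤ G
  z≤D = m+n≤o⇒m≤o z (≤-trans (≤-reflexive z+e₀≡Q) (shadow-bound K m q q≤C))
  -- the window [z, Q) of B is at most its final window [r, G)
  window : prefix B Q + prefix B r ≤ prefix B z + sum B
  window = ≤-cast (cong (λ u → prefix B u + prefix B r) (sym z+e₀≡Q)) refl
    (finalMaximal (colex-facts m K) z e₀ r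
      (≤-trans (≤-reflexive z+e₀≡Q) (≤-trans (shadow-bound K m q q≤C) (≤-reflexive (sym (colex-length K m)))))
      (trans (+-comm r e₀) (trans e₀+r≡ (sym (colex-length K m)))))
  combine : ∀ (q pQ pr pz sB pz' sA : ℕ) → q ≤ pQ → pQ + pr ≤ pz + sB → pz ≤ pz' → (sA + pr) + q ≤ (sA + sB) + pz'
  combine q pQ pr pz sB pz' sA h₁ h₂ h₃ =
    ≤-by-balance (+-mono-≤ (+-mono-≤ h₁ h₂) h₃) (solve (q ∷ pQ ∷ pr ∷ pz ∷ sB ∷ pz' ∷ sA ∷ []))

-- p and q both in the first block: the sets avoiding m, where the inequality over
-- {0,…,m-1} (the hypothesis) carries over unchanged.
main-first-block : ∀ K m p q → q ≤ p → p ≤ binom m (suc K) →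
  prefix (colex (suc K) m) p + q ≤ prefix (colex (suc K) (suc m)) (p + shadow (suc K) m q) →
  prefix (colex (suc K) (suc m)) p + q ≤ prefix (colex (suc K) (suc (suc m))) (p + shadow (suc K) (suc m) q)
main-first-block K m p q q≤p p≤F below =
  ≤-cast (cong (_+ q) (prefix-++ˡ (colex (suc K) m) (colex K m) p (≤-trans p≤F (≤-reflexive (sym (colex-length (suc K) m))))))
    (trans (cong (λ z → prefix (colex (suc K) (suc (suc m))) (p + z)) (shadow-low K m q q≤F))
      (prefix-ground-step K (suc m) _ (+-mono-≤ p≤F (shadow-bound K m q q≤F))))
    below
  where
  q≤F : q ≤ binom m (suc K)
  q≤F = ≤-trans q≤p p≤F

-- p = F + r and q = F + t + 1 both in the second block: the sets containing m, i.e. the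
-- inequality (the hypothesis) for K-sets of {0,…,m-1}, shifted by the first block.
main-second-block-both : ∀ K m r t →
  prefix (colex K m) r + suc t ≤ prefix (colex K (suc m)) (r + shadow K m (suc t)) →
  prefix (colex (suc K) (suc m)) (binom m (suc K) + r) + (binom m (suc K) + suc t)
    ≤ prefix (colex (suc K) (suc (suc m))) (binom m (suc K) + r + shadow (suc K) (suc m) (binom m (suc K) + suc t))
main-second-block-both K m r t below =
  ≤-cast (cong (_+ (F + suc t)) (prefix-++ʳ A B r (cong (_+ r) (sym (colex-length (suc K) m)))))
    (begin-equality
      prefix (colex (suc K) (suc (suc m))) (F + r + shadow (suc K) (suc m) (F + suc t))
        ≡⟨ cong (λ y → prefix (colex (suc K) (suc (suc m))) (F + r + y)) (shadow-high K m t) ⟩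
      prefix (colex (suc K) (suc (suc m))) (F + r + (binom m K + X))
        ≡⟨ cong (prefix (colex (suc K) (suc (suc m)))) (shuffle F r (binom m K) X) ⟩
      prefix (colex (suc K) (suc m) ++ colex K (suc m)) (F + binom m K + (r + X))
        ≡⟨ prefix-++ʳ (colex (suc K) (suc m)) (colex K (suc m)) (r + X) (cong (_+ (r + X)) (sym (colex-length (suc K) (suc m)))) ⟩
      sum (A ++ B) + prefix (colex K (suc m)) (r + X)
        ≡⟨ cong (_+ prefix (colex K (suc m)) (r + X)) (trans (sum-++ A B) (cong (sum A +_) (colex-sum K m))) ⟩
      (sum A + F) + prefix (colex K (suc m)) (r + X) ∎)
    (combine (prefix B r) (suc t) (prefix (colex K (suc m)) (r + X)) (sum A) F below)
  where
  open ≤-Reasoning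
  F X : ℕ
  F = binom m (suc K)
  X = shadow K m (suc t)
  A B : List ℕ
  A = colex (suc K) m
  B = colex K m
  shuffle : ∀ c r d x → c + r + (d + x) ≡ c + d + (r + x)
  shuffle = solve-∀
  combine : ∀ (pr st X sA F : ℕ) → pr + st ≤ X → (sA + pr) + (F + st) ≤ (sA + F) + X
  combine pr st X sA F h = ≤-by-balance h (solve (pr ∷ st ∷ X ∷ sA ∷ F ∷ []))

main-inequality : ∀ K m p q → q ≤ p → p ≤ binom m K →
  prefix (colex K m) p + q ≤ prefix (colex K (suc m)) (p + shadow K m q)
main-inequality zero m zero zero _ _ = z≤n
main-inequality zero m (suc zero) q q≤1 _ =
  ≤-trans (≤-reflexive (cong (_+ q) (+-identityʳ m)))
    (≤-trans (+-monoʳ-≤ m q≤1) (≤-reflexive (trans (+-comm m 1) (sym (+-identityʳ (suc m))))))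
main-inequality zero m (suc (suc p)) q _ (s≤s ())
main-inequality (suc K) zero zero zero _ _ = z≤n
main-inequality (suc K) (suc m) p q q≤p p≤ with ≤-or-beyond p (binom m (suc K))
... | inj₁ p≤F = main-first-block K m p q q≤p p≤F (main-inequality (suc K) m p q q≤p p≤F)
... | inj₂ (r , refl) with ≤-or-strictly-beyond q (binom m (suc K))
...   | inj₁ q≤F with ≤-or-beyond (r + shadow (suc K) m q) (binom m K)
...     | inj₁ r+Q≤ = main-second-block-fits K m r q q≤F r+Q≤
...     | inj₂ (z , r+Q≡) =
  main-second-block-overflows K m r q z q≤F (+-cancelˡ-≤ (binom m (suc K)) _ _ p≤) r+Q≡
main-inequality (suc K) (suc m) _ _ q≤p p≤ | inj₂ (r , refl) | inj₂ (t , refl) =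
  main-second-block-both K m r t
    (main-inequality K m r (suc t) (+-cancelˡ-≤ (binom m (suc K)) _ _ q≤p) (+-cancelˡ-≤ (binom m (suc K)) _ _ p≤))

binomSum : (s : ℕ) → (Fin (suc s) → ℕ) → ℕ → ℕ
binomSum s c n = Σ≤ s (λ i → binom (c i) (n ∸ toℕ i))

Σ≤-cong : ∀ s (f g : Fin (suc s) → ℕ) → (∀ i → f i ≡ g i) → Σ≤ s f ≡ Σ≤ s g
Σ≤-cong zero f g f≗g = cong (_+ 0) (f≗g fz)
Σ≤-cong (suc s) f g f≗g = cong₂ _+_ (f≗g fz) (Σ≤-cong s (λ i → f (fs i)) (λ i → g (fs i)) (λ i → f≗g (fs i)))

-- How a canonical representation x = Σᵢ (cᵢ choose k-i) sits in the model over any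
-- ground set {0,…,M-1} with M > c₀: x counts an initial segment of the k-sets, its
-- colex prefix sum is the upper function and its shadow is the lower function.
record InModel (s k : ℕ) (c : Fin (suc s) → ℕ) : Set where
  field
    top-large  : k ≤ c fz
    value-fits : binomSum s c k ≤ binom (suc (c fz)) k
    upper      : ∀ d → prefix (colex k (suc (c fz) + d)) (binomSum s c k) ≡ binomSum s c (suc k)
    lower      : ∀ d → shadow k (suc (c fz) + d) (binomSum s c k) ≡ binomSum s c (k ∸ 1)

open InModel

-- By induction on the length: the leading term (c₀ choose k) fills the first block of
-- colex k (c₀+1), and the remaining terms form a canonical (k-1)-representation whose
-- value fits into the second block.
canonical-in-model : ∀ s k (c : Fin (suc s) → ℕ) → s < k → (∀ i j → i <ᶠ j → c j < c i) →
  k ∸ s ≤ c (fromℕ s) → InModel s k c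
canonical-in-model zero (suc k') c (s≤s _) _ k≤c₀ = record
  { top-large = k≤c₀
  ; value-fits = fits
  ; upper = λ d → trans (sym (prefix-ground k' (suc c₀) d _ fits))
      (trans (prefix-++ʳ (colex (suc k') c₀) (colex k' c₀) 0 (cong (_+ 0) (sym (colex-length (suc k') c₀))))
        (cong (_+ 0) (colex-sum (suc k') c₀)))
  ; lower = λ d → trans (sym (shadow-ground (suc k') (suc c₀) d _ fits))
      (trans (shadow-high′ k' c₀ 0 k≤c₀) (cong (binom c₀ k' +_) (shadow-zero k' c₀)))
  }
  where
  c₀ : ℕ
  c₀ = c fz
  fits : binom c₀ (suc k') + 0 ≤ binom (suc c₀) (suc k')
  fits = +-monoʳ-≤ (binom c₀ (suc k')) z≤n
canonical-in-model (suc s') (suc k') c (s≤s s'<k') decr last≥ = record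
  { top-large = k≤c₀
  ; value-fits = fits
  ; upper = λ d → trans (sym (prefix-ground k' (suc c₀) d _ fits))
      (trans (prefix-++ʳ (colex (suc k') c₀) (colex k' c₀) v (cong (_+ v) (sym (colex-length (suc k') c₀))))
        (cong₂ _+_ (colex-sum (suc k') c₀) (trans (cong (λ z → prefix (colex k' z) v) (sym c₀≡)) (upper tail d₁))))
  ; lower = λ d → trans (sym (shadow-ground (suc k') (suc c₀) d _ fits))
      (trans (shadow-high′ k' c₀ v k≤c₀)
        (cong (binom c₀ k' +_) (trans (cong (λ z → shadow k' z v) (sym c₀≡))
          (trans (lower tail d₁) (Σ≤-cong s' _ _ (λ i → cong (binom (c (fs i))) (∸-+-assoc k' 1 (toℕ i))))))))
  }
  where
  c₀ c₁ : ℕ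
  c₀ = c fz
  c₁ = c (fs fz)
  tail : InModel s' k' (λ i → c (fs i))
  tail = canonical-in-model s' k' (λ i → c (fs i)) s'<k' (λ i j i<j → decr (fs i) (fs j) (s≤s i<j)) last≥
  v : ℕ
  v = binomSum s' (λ i → c (fs i)) k'
  c₁<c₀ : c₁ < c₀
  c₁<c₀ = decr fz (fs fz) (s≤s z≤n)
  d₁ : ℕ
  d₁ = proj₁ (complement c₁<c₀)
  c₀≡ : suc c₁ + d₁ ≡ c₀
  c₀≡ = trans (+-comm (suc c₁) d₁) (proj₂ (complement c₁<c₀))
  k≤c₀ : suc k' ≤ c₀
  k≤c₀ = ≤-trans (s≤s (top-large tail)) c₁<c₀
  v≤ : v ≤ binom c₀ k'
  v≤ = ≤-trans (value-fits tail) (≤-trans (binom-mono (suc c₁) d₁ k') (≤-reflexive (cong (λ z → binom z k') c₀≡)))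
  fits : binom c₀ (suc k') + v ≤ binom (suc c₀) (suc k')
  fits = +-monoʳ-≤ (binom c₀ (suc k')) v≤

module _ {k x : ℕ} (r : CanonRep k x) where

  shiftSum≡binomSum : ∀ n → shiftSum r n ≡ binomSum (s r) (coeff r) n
  shiftSum≡binomSum n = Σ≤-cong (s r) _ _ (λ i → sym (binom≡C (coeff r i) (n ∸ toℕ i)))

  model : InModel (s r) k (coeff r)
  model = canonical-in-model (s r) k (coeff r) (s<k r) (decr r) (lastGe r)

  value≡ : x ≡ binomSum (s r) (coeff r) k
  value≡ = trans (sumEq r) (shiftSum≡binomSum k)

  canonical-fits : x ≤ binom (suc (coeff r fz)) k
  canonical-fits = ≤-trans (≤-reflexive value≡) (value-fits model)

  upper-function : ∀ {k'} m → k ≡ suc k' → x ≤ binom m k → shiftSum r (k + 1) ≡ prefix (colex k m) x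
  upper-function {k'} m refl x≤ = begin
    shiftSum r (suc k' + 1)                                ≡⟨ cong (shiftSum r) (+-comm (suc k') 1) ⟩
    shiftSum r (suc (suc k'))                              ≡⟨ shiftSum≡binomSum (suc (suc k')) ⟩
    binomSum (s r) (coeff r) (suc (suc k'))                ≡⟨ upper model m ⟨
    prefix (colex (suc k') (suc (coeff r fz) + m)) (binomSum (s r) (coeff r) (suc k'))
                                                           ≡⟨ cong (prefix (colex (suc k') (suc (coeff r fz) + m))) value≡ ⟨
    prefix (colex (suc k') (suc (coeff r fz) + m)) x       ≡⟨ cong (λ z → prefix (colex (suc k') z) x) (+-comm (suc (coeff r fz)) m) ⟩
    prefix (colex (suc k') (m + suc (coeff r fz))) x       ≡⟨ prefix-ground k' m _ x x≤ ⟨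
    prefix (colex (suc k') m) x                            ∎
    where open ≡-Reasoning

  lower-function : ∀ m → x ≤ binom m k → shiftSum r (k ∸ 1) ≡ shadow k m x
  lower-function m x≤ = begin
    shiftSum r (k ∸ 1)                                     ≡⟨ shiftSum≡binomSum (k ∸ 1) ⟩
    binomSum (s r) (coeff r) (k ∸ 1)                       ≡⟨ lower model m ⟨
    shadow k (suc (coeff r fz) + m) (binomSum (s r) (coeff r) k)
                                                           ≡⟨ cong (shadow k (suc (coeff r fz) + m)) value≡ ⟨
    shadow k (suc (coeff r fz) + m) x                      ≡⟨ cong (λ z → shadow k z x) (+-comm (suc (coeff r fz)) m) ⟩
    shadow k (m + suc (coeff r fz)) x                      ≡⟨ shadow-ground k m _ x x≤ ⟨
    shadow k m x                                           ∎
    where open ≡-Reasoning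

-- Lemma 3.3.  With m = a₀ + 1, all of p, q, N are initial segments in the model, the
-- three upper/lower functions become colex prefix sums and shadows, and the claim is
-- the main inequality.
lemma3p3 : (k p q N : ℕ) → 1 ≤ k → 1 ≤ q → q ≤ p →
    (ra : CanonRep k p) → (rb : CanonRep k q) →
    N ≡ p + shiftSum rb (k ∸ 1) →
    (rc : CanonRep k N) →
    shiftSum rc (k + 1) ≥ shiftSum ra (k + 1) + shiftSum rb k
lemma3p3 (suc k') p q N _ _ q≤p ra rb N≡ rc =
  ≤-cast (cong₂ _+_ (upper-function ra m refl p≤) (sym (sumEq rb)))
         (trans (upper-function rc (suc m) refl N≤) (cong (prefix (colex k (suc m))) N≡′))
    (main-inequality k m p q q≤p p≤)
  where
  k m : ℕ
  k = suc k'
  m = suc (coeff ra fz)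
  p≤ : p ≤ binom m k
  p≤ = canonical-fits ra
  q≤ : q ≤ binom m k
  q≤ = ≤-trans q≤p p≤
  N≡′ : N ≡ p + shadow k m q
  N≡′ = trans N≡ (cong (p +_) (lower-function rb m q≤))
  N≤ : N ≤ binom (suc m) k
  N≤ = ≤-trans (≤-reflexive N≡′) (+-mono-≤ p≤ (shadow-bound k' m q q≤))
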